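{- Let $P$ be a connected finite poset with at least two points and let $C\subseteq E(P)$ be a 4-crown of $P$ with $L(C)=\{a,b\}$, $U(C)=\{v,w\}$. There exists a $C$-separating homomorphism from $\mathfrak{F}(P)$ to $\mathfrak{C}$ if and only if there exists a $C$-separating homomorphism from $\mathfrak{F}(P)$ to $\mathfrak{C}_3$.
   Context: All posets are finite; subsets are identified with induced subposets. $L(P)$, $U(P)$: minimal and maximal points of $P$; $E(P)=L(P)\cup U(P)$. $[x,y]_P=\{z: x\leq_P z\leq_P y\}$. A crown is a subset whose comparability graph is a cycle; a 4-crown $D=\{a,b,v,w\}$ with $L(D)=\{a,b\}$, $U(D)=\{v,w\}$ is improper if $[a,v]_P\cap[b,w]_P\neq\emptyset$. $\mathcal{C}_{23}$: the subsets of $C$ with 2 or 3 elements which are connected as induced subposets of $C$ (the four comparable pairs and $abv,abw,avw,bvw$, where $xyz=\{x,y,z\}$). $\mathfrak{C}$: multigraph on $\mathcal{C}_{23}$ with an L-edge between $S,T$ (loops allowed) iff $L(C)\cap S\cap T\neq\emptyset$ and a U-edge iff $U(C)\cap S\cap T\neq\emptyset$. $\mathcal{C}_3=\{S\in\mathcal{C}_{23}:\#S=3\}$ and $\mathfrak{C}_3$ is the sub-multigraph of $\mathfrak{C}$ induced by $\mathcal{C}_3$. $\mathcal{A},\mathcal{B},\mathcal{V},\mathcal{W}$ are the sets of $S\in\mathcal{C}_{23}$ with $L(C)\cap S=\{a\}$, $L(C)\cap S=\{b\}$, $U(C)\cap S=\{v\}$, $U(C)\cap S=\{w\}$ respectively.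 $\mathcal{F}(P)$: the set of improper 4-crowns of $P$ contained in $E(P)$; $\mathfrak{F}(P)$: multigraph on $\mathcal{F}(P)$ with L-edge between $F,G$ iff $L(P)\cap F\cap G\neq\emptyset$ and U-edge iff $U(P)\cap F\cap G\neq\emptyset$. A homomorphism $\phi$ from $\mathfrak{F}(P)$ to $\mathfrak{C}$ (resp. $\mathfrak{C}_3$) is a map $\mathcal{F}(P)\to\mathcal{C}_{23}$ (resp. $\to\mathcal{C}_3$) sending L-edges to L-edges and U-edges to U-edges. $\phi$ is $C$-separating if there exist $x\neq x'$ in $L(P)$ and $y\neq y'$ in $U(P)$ with $\{x,x',y,y'\}=C$ such that for all $F\in\mathcal{F}(P)$: $x\in F\Rightarrow\phi(F)\notin\mathcal{A}$; $x'\in F\Rightarrow\phi(F)\notin\mathcal{B}$; $y\in F\Rightarrow\phi(F)\notin\mathcal{V}$; $y'\in F\Rightarrow\phi(F)\notin\mathcal{W}$. -}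

module Defs where

open import Level using (0ℓ)
open import Data.Nat using (ℕ; _≤_)
open import Data.Fin using (Fin)
open import Data.Fin.Subset using (Subset; _∈_; _∉_)
open import Data.Product using (Σ; ∃; ∃-syntax; _×_; _,_)
open import Data.Sum using (_⊎_)
open import Data.Empty using (⊥)
open import Data.Unit using (⊤)
open import Relation.Nullary using (¬_)
open import Relation.Binary using (IsPartialOrder; Decidable)
open import Relation.Binary.PropositionalEquality using (_≡_; _≢_)
open import Relation.Binary.Construct.Closure.ReflexiveTransitive using (Star)
open import Function.Bundles using (_⇔_)

record FinPoset : Set₁ where
  field
    size      : ℕ
    _≼_       : Fin size → Fin size → Set
    isPO      : IsPartialOrder _≡_ _≼_
    decidable : Decidable _≼_

module _ (P : FinPoset) where
  open FinPoset P

  Pt : Set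
  Pt = Fin size

  _≺_ : Pt → Pt → Set
  x ≺ y = x ≼ y × x ≢ y

  Comparable : Pt → Pt → Set
  Comparable x y = x ≼ y ⊎ y ≼ x

  Connected : Set
  Connected = ∀ x y → Star Comparable x y

  IsMin : Pt → Set
  IsMin x = ∀ y → y ≼ x → y ≡ x

  IsMax : Pt → Set
  IsMax x = ∀ y → x ≼ y → y ≡ x

  InE : Pt → Set
  InE x = IsMin x ⊎ IsMax x

  IsCrown4 : Pt → Pt → Pt → Pt → Set
  IsCrown4 a b v w =
    a ≺ v × a ≺ w × b ≺ v × b ≺ w ×
    ¬ Comparable a b × ¬ Comparable v w

  InInterval : Pt → Pt → Pt → Set
  InInterval x y z = x ≼ z × z ≼ y

  Improper : Pt → Pt → Pt → Pt → Set
  Improper a b v w = ∃[ z ] (InInterval a v z × InInterval b w z)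

  IsSet4 : Subset size → Pt → Pt → Pt → Pt → Set
  IsSet4 S a b v w = ∀ x → (x ∈ S) ⇔ (x ≡ a ⊎ x ≡ b ⊎ x ≡ v ⊎ x ≡ w)

  In𝓕 : Subset size → Set
  In𝓕 F =
    (∃[ a ] ∃[ b ] ∃[ v ] ∃[ w ]
       (IsSet4 F a b v w × IsCrown4 a b v w × Improper a b v w))
    × (∀ x → x ∈ F → InE x)

data CPt : Set where
  ca cb cv cw : CPt

IsLC : CPt → Set
IsLC ca = ⊤
IsLC cb = ⊤
IsLC cv = ⊥
IsLC cw = ⊥

IsUC : CPt → Set
IsUC ca = ⊥
IsUC cb = ⊥
IsUC cv = ⊤
IsUC cw = ⊤

-- connected 2- and 3-element subsets of C
data C23 : Set where
  av aw bv bw abv abw avw bvw : C23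

_∈C_ : CPt → C23 → Set
ca ∈C av  = ⊤
cv ∈C av  = ⊤
ca ∈C aw  = ⊤
cw ∈C aw  = ⊤
cb ∈C bv  = ⊤
cv ∈C bv  = ⊤
cb ∈C bw  = ⊤
cw ∈C bw  = ⊤
ca ∈C abv = ⊤
cb ∈C abv = ⊤
cv ∈C abv = ⊤
ca ∈C abw = ⊤
cb ∈C abw = ⊤
cw ∈C abw = ⊤
ca ∈C avw = ⊤
cv ∈C avw = ⊤
cw ∈C avw = ⊤
cb ∈C bvw = ⊤
cv ∈C bvw = ⊤
cw ∈C bvw = ⊤
_  ∈C _   = ⊥

Is3 : C23 → Set
Is3 abv = ⊤
Is3 abw = ⊤
Is3 avw = ⊤
Is3 bvw = ⊤
Is3 _   = ⊥

LEdgeC : C23 → C23 → Set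
LEdgeC S T = ∃[ p ] (IsLC p × p ∈C S × p ∈C T)

UEdgeC : C23 → C23 → Set
UEdgeC S T = ∃[ p ] (IsUC p × p ∈C S × p ∈C T)

In𝒜 In𝓑 In𝒱 In𝒲 : C23 → Set
In𝒜 S = ca ∈C S × ¬ (cb ∈C S)
In𝓑 S = cb ∈C S × ¬ (ca ∈C S)
In𝒱 S = cv ∈C S × ¬ (cw ∈C S)
In𝒲 S = cw ∈C S × ¬ (cv ∈C S)

-- Homomorphisms 𝔉(P) → ℭ.  A map 𝓕(P) → 𝒞₂₃ is represented by a
-- total function on subsets of P, only its values on 𝓕(P) matter.

module _ (P : FinPoset) where
  open FinPoset P

  LEdgeF : Subset size → Subset size → Set
  LEdgeF F G = ∃[ x ] (IsMin P x × x ∈ F × x ∈ G)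

  UEdgeF : Subset size → Subset size → Set
  UEdgeF F G = ∃[ y ] (IsMax P y × y ∈ F × y ∈ G)

  IsHom : (Subset size → C23) → Set
  IsHom φ =
    (∀ F G → In𝓕 P F → In𝓕 P G → LEdgeF F G → LEdgeC (φ F) (φ G)) ×
    (∀ F G → In𝓕 P F → In𝓕 P G → UEdgeF F G → UEdgeC (φ F) (φ G))

  -- values in 𝒞₃ (homomorphism into the induced sub-multigraph ℭ₃)
  Into3 : (Subset size → C23) → Set
  Into3 φ = ∀ F → In𝓕 P F → Is3 (φ F)

  CSeparating : Fin size → Fin size → Fin size → Fin size →
                (Subset size → C23) → Set
  CSeparating a b v w φ =
    ∃[ x ] ∃[ x' ] ∃[ y ] ∃[ y' ]
      ( x ≢ x' × IsMin P x × IsMin P x'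
      × y ≢ y' × IsMax P y × IsMax P y'
      × (∀ z → (z ≡ x ⊎ z ≡ x' ⊎ z ≡ y ⊎ z ≡ y')
             ⇔ (z ≡ a ⊎ z ≡ b ⊎ z ≡ v ⊎ z ≡ w))
      × (∀ F → In𝓕 P F →
           (x  ∈ F → ¬ In𝒜 (φ F)) ×
           (x' ∈ F → ¬ In𝓑 (φ F)) ×
           (y  ∈ F → ¬ In𝒱 (φ F)) ×
           (y' ∈ F → ¬ In𝒲 (φ F))))

{-# OPTIONS --safe #-}
module Submission where

-- A homomorphism into ℭ₃ is one into ℭ. Conversely, enlarge each of the
-- pairs av, aw, bv, bw by the other minimal point of C. This map only
-- enlarges sets, so composing with it keeps L- and U-edges; and a set lies
-- in 𝒜, ℬ, 𝒱 or 𝒲 after enlargement only if it already did, so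
-- C-separation (with the same witnesses) is kept as well.

open import Defs
open import Data.Nat using (_≤_)
open import Data.Product using (∃-syntax; _×_; _,_)
open import Data.Unit using (tt)
open import Data.Empty using (⊥-elim)
open import Data.Fin.Subset using (Subset)
open import Function.Base using (_∘_)
open import Function.Bundles using (_⇔_; mk⇔)

Expanding : (C23 → C23) → Set
Expanding ψ = ∀ {p} S → p ∈C S → p ∈C ψ S

ReflectsSides : (C23 → C23) → Set
ReflectsSides ψ = ∀ S →
  (In𝒜 (ψ S) → In𝒜 S) × (In𝓑 (ψ S) → In𝓑 S) ×
  (In𝒱 (ψ S) → In𝒱 S) × (In𝒲 (ψ S) → In𝒲 S)

module _ (P : FinPoset) {ψ : C23 → C23} where
  open FinPoset P using (size)

  IsHom-∘ : Expanding ψ → {φ : Subset size → C23} →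
            IsHom P φ → IsHom P (ψ ∘ φ)
  IsHom-∘ expand {φ} (homL , homU) =
      (λ F G 𝓕F 𝓕G e → keep (homL F G 𝓕F 𝓕G e))
    , (λ F G 𝓕F 𝓕G e → keep (homU F G 𝓕F 𝓕G e))
    where
    keep : ∀ {Q : CPt → Set} {S T} →
           ∃[ p ] (Q p × p ∈C S × p ∈C T) →
           ∃[ p ] (Q p × p ∈C ψ S × p ∈C ψ T)
    keep {S = S} {T} (p , q , p∈S , p∈T) = p , q , expand S p∈S , expand T p∈T

  CSeparating-∘ : ReflectsSides ψ → ∀ {a b v w} {φ : Subset size → C23} →
                  CSeparating P a b v w φ → CSeparating P a b v w (ψ ∘ φ)
  CSeparating-∘ reflect {φ = φ}
    (x , x' , y , y' , x≢x' , x-min , x'-min , y≢y' , y-max , y'-max , same , sep) =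
    x , x' , y , y' , x≢x' , x-min , x'-min , y≢y' , y-max , y'-max , same ,
    λ F 𝓕F → let (¬𝒜 , ¬𝓑 , ¬𝒱 , ¬𝒲) = sep F 𝓕F
                 (𝒜⁻ , 𝓑⁻ , 𝒱⁻ , 𝒲⁻) = reflect (φ F)
             in (λ x∈F → ¬𝒜 x∈F ∘ 𝒜⁻) , (λ x'∈F → ¬𝓑 x'∈F ∘ 𝓑⁻)
              , (λ y∈F → ¬𝒱 y∈F ∘ 𝒱⁻) , (λ y'∈F → ¬𝒲 y'∈F ∘ 𝒲⁻)

enlarge : C23 → C23
enlarge av = abv
enlarge bv = abv
enlarge aw = abw
enlarge bw = abw
enlarge S  = S

Is3-enlarge : ∀ S → Is3 (enlarge S)
Is3-enlarge av  = tt
Is3-enlarge aw  = tt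
Is3-enlarge bv  = tt
Is3-enlarge bw  = tt
Is3-enlarge abv = tt
Is3-enlarge abw = tt
Is3-enlarge avw = tt
Is3-enlarge bvw = tt

enlarge-expanding : Expanding enlarge
enlarge-expanding {ca} av  _ = tt
enlarge-expanding {cv} av  _ = tt
enlarge-expanding {ca} aw  _ = tt
enlarge-expanding {cw} aw  _ = tt
enlarge-expanding {cb} bv  _ = tt
enlarge-expanding {cv} bv  _ = tt
enlarge-expanding {cb} bw  _ = tt
enlarge-expanding {cw} bw  _ = tt
enlarge-expanding      abv p∈S = p∈S
enlarge-expanding      abw p∈S = p∈S
enlarge-expanding      avw p∈S = p∈S
enlarge-expanding      bvw p∈S = p∈S

In𝒜-enlarge⁻ : ∀ S → In𝒜 (enlarge S) → In𝒜 S
In𝒜-enlarge⁻ avw a-only      = a-only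
In𝒜-enlarge⁻ bvw (() , _)
In𝒜-enlarge⁻ av  (_ , b∉S)   = ⊥-elim (b∉S tt)
In𝒜-enlarge⁻ aw  (_ , b∉S)   = ⊥-elim (b∉S tt)
In𝒜-enlarge⁻ bv  (_ , b∉S)   = ⊥-elim (b∉S tt)
In𝒜-enlarge⁻ bw  (_ , b∉S)   = ⊥-elim (b∉S tt)
In𝒜-enlarge⁻ abv (_ , b∉S)   = ⊥-elim (b∉S tt)
In𝒜-enlarge⁻ abw (_ , b∉S)   = ⊥-elim (b∉S tt)

In𝓑-enlarge⁻ : ∀ S → In𝓑 (enlarge S) → In𝓑 S
In𝓑-enlarge⁻ bvw b-only      = b-only
In𝓑-enlarge⁻ avw (() , _)
In𝓑-enlarge⁻ av  (_ , a∉S)   = ⊥-elim (a∉S tt)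
In𝓑-enlarge⁻ aw  (_ , a∉S)   = ⊥-elim (a∉S tt)
In𝓑-enlarge⁻ bv  (_ , a∉S)   = ⊥-elim (a∉S tt)
In𝓑-enlarge⁻ bw  (_ , a∉S)   = ⊥-elim (a∉S tt)
In𝓑-enlarge⁻ abv (_ , a∉S)   = ⊥-elim (a∉S tt)
In𝓑-enlarge⁻ abw (_ , a∉S)   = ⊥-elim (a∉S tt)

In𝒱-enlarge⁻ : ∀ S → In𝒱 (enlarge S) → In𝒱 S
In𝒱-enlarge⁻ av  _           = tt , λ ()
In𝒱-enlarge⁻ bv  _           = tt , λ ()
In𝒱-enlarge⁻ abv v-only      = v-only
In𝒱-enlarge⁻ aw  (() , _)
In𝒱-enlarge⁻ bw  (() , _)
In𝒱-enlarge⁻ abw (() , _)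
In𝒱-enlarge⁻ avw (_ , w∉S)   = ⊥-elim (w∉S tt)
In𝒱-enlarge⁻ bvw (_ , w∉S)   = ⊥-elim (w∉S tt)

In𝒲-enlarge⁻ : ∀ S → In𝒲 (enlarge S) → In𝒲 S
In𝒲-enlarge⁻ aw  _           = tt , λ ()
In𝒲-enlarge⁻ bw  _           = tt , λ ()
In𝒲-enlarge⁻ abw w-only      = w-only
In𝒲-enlarge⁻ av  (() , _)
In𝒲-enlarge⁻ bv  (() , _)
In𝒲-enlarge⁻ abv (() , _)
In𝒲-enlarge⁻ avw (_ , v∉S)   = ⊥-elim (v∉S tt)
In𝒲-enlarge⁻ bvw (_ , v∉S)   = ⊥-elim (v∉S tt)

enlarge-reflectsSides : ReflectsSides enlarge
enlarge-reflectsSides S =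
  In𝒜-enlarge⁻ S , In𝓑-enlarge⁻ S , In𝒱-enlarge⁻ S , In𝒲-enlarge⁻ S

theorem2 : (P : FinPoset) → 2 ≤ FinPoset.size P → Connected P →
    (a b v w : Pt P) → IsCrown4 P a b v w →
    InE P a → InE P b → InE P v → InE P w →
    (∃[ φ ] (IsHom P φ × CSeparating P a b v w φ))
      ⇔ (∃[ φ ] (IsHom P φ × Into3 P φ × CSeparating P a b v w φ))
theorem2 P _ _ a b v w _ _ _ _ _ = mk⇔ into3 forget3
  where
  into3 : ∃[ φ ] (IsHom P φ × CSeparating P a b v w φ) →
          ∃[ φ ] (IsHom P φ × Into3 P φ × CSeparating P a b v w φ)
  into3 (φ , hom , sep) =
      enlarge ∘ φ
    , IsHom-∘ P enlarge-expanding hom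
    , (λ F _ → Is3-enlarge (φ F))
    , CSeparating-∘ P enlarge-reflectsSides sep

  forget3 : ∃[ φ ] (IsHom P φ × Into3 P φ × CSeparating P a b v w φ) →
            ∃[ φ ] (IsHom P φ × CSeparating P a b v w φ)
  forget3 (φ , hom , _ , sep) = φ , hom , sep
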